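{- Let $\Gamma = (V, E)$ be a finite $d$-regular graph with $d \ge 1$, and let $C$ be a total perfect code in $\Gamma$. Then for every equitable partition $\pi = \{V_1, \ldots, V_m\}$ of $\Gamma$ there exists a vector $(k_1, \ldots, k_m)^T \in \mathbb{Q}^m$ such that $$|V_i \cap C| = \left(\frac{1}{d} + k_i\right)|V_i|, \quad i = 1, \ldots, m,$$ and $$A_\pi (k_1, \ldots, k_m)^T = (0, \ldots, 0)^T.$$
   Context: A total perfect code in $\Gamma$ is a set $C \subseteq V$ such that every vertex of $\Gamma$ is adjacent to exactly one vertex of $C$. An equitable partition of $\Gamma$ is a partition $\pi = \{V_1, \ldots, V_m\}$ of $V$ such that for all $i, j$ the number $b_{ij}$ of neighbours in $V_j$ of a vertex $u \in V_i$ does not depend on the choice of $u \in V_i$. Its quotient matrix is $A_\pi = (b_{ij})_{1 \le i, j \le m}$. -}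

module Defs where

open import Data.Nat using (ℕ; zero; suc; _+_)
open import Data.Bool using (Bool; true; false; _∧_)
open import Data.Fin using (Fin; zero; suc; _≟_)
open import Data.Product using (Σ; ∃; _×_)
open import Relation.Nullary.Decidable using (⌊_⌋)
open import Relation.Binary.PropositionalEquality using (_≡_)
open import Data.Rational using (ℚ; 0ℚ) renaming (_+_ to _+ℚ_)

count : {n : ℕ} → (Fin n → Bool) → ℕ
count {zero}  P = 0
count {suc n} P with P zero
... | true  = suc (count (λ i → P (suc i)))
... | false = count (λ i → P (suc i))

Σℚ : {m : ℕ} → (Fin m → ℚ) → ℚ
Σℚ {zero}  f = 0ℚ
Σℚ {suc m} f = f zero +ℚ Σℚ (λ i → f (suc i))

record Graph (n : ℕ) : Set where
  field
    adj   : Fin n → Fin n → Bool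
    sym   : ∀ u v → adj u v ≡ adj v u
    irrefl : ∀ u → adj u u ≡ false

open Graph public

degIn : {n : ℕ} → Graph n → (Fin n → Bool) → Fin n → ℕ
degIn Γ S u = count (λ v → adj Γ u v ∧ S v)

full : {n : ℕ} → Fin n → Bool
full _ = true

Regular : {n : ℕ} → Graph n → ℕ → Set
Regular Γ d = ∀ u → degIn Γ full u ≡ d

TotalPerfectCode : {n : ℕ} → Graph n → (Fin n → Bool) → Set
TotalPerfectCode Γ C = ∀ u → degIn Γ C u ≡ 1

cell : {n m : ℕ} → (Fin n → Fin m) → Fin m → Fin n → Bool
cell p i v = ⌊ p v ≟ i ⌋

-- partition {V_1,…,V_m} of Fin n: assignment map with every cell nonempty
IsPartition : {n m : ℕ} → (Fin n → Fin m) → Set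
IsPartition p = ∀ i → ∃ λ v → p v ≡ i

IsQuotientMatrix : {n m : ℕ} → Graph n → (Fin n → Fin m) → (Fin m → Fin m → ℕ) → Set
IsQuotientMatrix Γ p b = ∀ u j → degIn Γ (cell p j) u ≡ b (p u) j

record EquitablePartition {n : ℕ} (Γ : Graph n) (m : ℕ) : Set where
  field
    part       : Fin n → Fin m
    isPartition : IsPartition part
    quotient   : Fin m → Fin m → ℕ
    equitable  : IsQuotientMatrix Γ part quotient

open EquitablePartition public

-- Write n_i = |V_i| and c_i = |V_i ∩ C|. The whole argument rests on three counting
-- identities, each obtained by counting edges in two ways:
--   (balanced)    n_i b_ij = n_j b_ji        (edges between V_i and V_j),
--   (column sum)  Σ_j c_j b_ji = n_i         (every vertex of V_i has one neighbour in C),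
--   (row sum)     Σ_j b_ij = d               (Γ is d-regular).
-- Given these, Σ_j b_ij c_j/n_j = (1/n_i) Σ_j c_j b_ji = 1 = Σ_j b_ij (1/d), so b k = 0.
module Submission where

open import Defs hiding (sym)
open import Data.Nat using (ℕ; NonZero; zero; suc)
open import Data.Bool using (Bool; true; false; _∧_)
open import Data.Fin using (Fin; zero; suc; _≟_)
open import Data.Product using (Σ; _×_; _,_)
open import Function using (_∘_)
open import Relation.Binary.PropositionalEquality
  using (_≡_; refl; sym; trans; cong; cong₂; module ≡-Reasoning)
import Data.Nat.Properties as ℕ
import Algebra.Properties.Semiring.Sum as SemiringSum
open SemiringSum ℕ.+-*-semiring using (sum-syntax)

module Counting where

  open import Data.Nat using (_+_; _*_)
  open import Data.Nat.Properties using (*-identityˡ; *-identityʳ; +-identityʳ; *-assoc; *-comm)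
  open import Relation.Nullary.Decidable using (⌊_⌋; yes; no)
  open import Relation.Nullary.Negation using (contradiction)
  open SemiringSum ℕ.+-*-semiring
    using (sum-cong-≗; sum-replicate-zero; ∑-comm; *-distribˡ-sum; *-distribʳ-sum)
  import Data.Nat.Solver
  open ≡-Reasoning

  ⟦_⟧ : Bool → ℕ
  ⟦ true  ⟧ = 1
  ⟦ false ⟧ = 0

  ⟦∧⟧ : ∀ a b → ⟦ a ∧ b ⟧ ≡ ⟦ a ⟧ * ⟦ b ⟧
  ⟦∧⟧ true  b = sym (+-identityʳ ⟦ b ⟧)
  ⟦∧⟧ false b = refl

  count≡∑ : ∀ {n} (P : Fin n → Bool) → count P ≡ ∑[ v < n ] ⟦ P v ⟧
  count≡∑ {zero}  P = refl
  count≡∑ {suc n} P with P zero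
  ... | true  = cong suc (count≡∑ (P ∘ suc))
  ... | false = count≡∑ (P ∘ suc)

  count-nonZero : ∀ {n} (P : Fin n → Bool) v → P v ≡ true → NonZero (count P)
  count-nonZero {suc n} P v Pv with P zero in P0
  ... | true = _
  count-nonZero {suc n} P zero    Pv | false = contradiction (trans (sym P0) Pv) λ ()
  count-nonZero {suc n} P (suc v) Pv | false = count-nonZero (P ∘ suc) v Pv

  ∑-cell-membership : ∀ {m} (x : Fin m) → ∑[ j < m ] ⟦ ⌊ x ≟ j ⌋ ⟧ ≡ 1
  ∑-cell-membership {suc m} zero    = cong suc (sum-replicate-zero m)
  ∑-cell-membership {suc m} (suc x) =
    trans (sum-cong-≗ (cong ⟦_⟧ ∘ ≟-suc x)) (∑-cell-membership x)
    where
    ≟-suc : ∀ {m} (x j : Fin m) → ⌊ suc x ≟ suc j ⌋ ≡ ⌊ x ≟ j ⌋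
    ≟-suc x j with x ≟ j
    ... | yes _ = refl
    ... | no  _ = refl

  cell-restrict : ∀ {m} (x j : Fin m) {a b : ℕ} → (x ≡ j → a ≡ b) →
    ⟦ ⌊ x ≟ j ⌋ ⟧ * a ≡ ⟦ ⌊ x ≟ j ⌋ ⟧ * b
  cell-restrict x j a≡b with x ≟ j
  ... | yes x≡j = cong (_+ 0) (a≡b x≡j)
  ... | no  _   = refl

  module _ {n m : ℕ} (p : Fin n → Fin m) where

    ∑-over-cells : (f : Fin n → ℕ) →
      ∑[ j < m ] ∑[ v < n ] (⟦ cell p j v ⟧ * f v) ≡ ∑[ v < n ] f v
    ∑-over-cells f = begin
      ∑[ j < m ] ∑[ v < n ] (⟦ cell p j v ⟧ * f v)  ≡⟨ ∑-comm (λ j v → ⟦ cell p j v ⟧ * f v) ⟩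
      ∑[ v < n ] ∑[ j < m ] (⟦ cell p j v ⟧ * f v)  ≡⟨ sum-cong-≗ (λ v → sym (*-distribʳ-sum (f v) (λ j → ⟦ cell p j v ⟧))) ⟩
      ∑[ v < n ] ((∑[ j < m ] ⟦ cell p j v ⟧) * f v) ≡⟨ sum-cong-≗ (λ v → cong (_* f v) (∑-cell-membership (p v))) ⟩
      ∑[ v < n ] (1 * f v)                          ≡⟨ sum-cong-≗ (λ v → *-identityˡ (f v)) ⟩
      ∑[ v < n ] f v                                ∎

    ∑-cell-constant : ∀ i (f : Fin n → ℕ) {c : ℕ} → (∀ v → p v ≡ i → f v ≡ c) →
      ∑[ v < n ] (⟦ cell p i v ⟧ * f v) ≡ count (cell p i) * c
    ∑-cell-constant i f {c} const = begin
      ∑[ v < n ] (⟦ cell p i v ⟧ * f v)  ≡⟨ sum-cong-≗ (λ v → cell-restrict (p v) i (const v)) ⟩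
      ∑[ v < n ] (⟦ cell p i v ⟧ * c)    ≡⟨ sym (*-distribʳ-sum c (λ v → ⟦ cell p i v ⟧)) ⟩
      (∑[ v < n ] ⟦ cell p i v ⟧) * c    ≡⟨ cong (_* c) (sym (count≡∑ (cell p i))) ⟩
      count (cell p i) * c               ∎

    ∑-regroup : (g h : Fin n → ℕ) (H : Fin m → ℕ) → (∀ v → h v ≡ H (p v)) →
      ∑[ j < m ] ((∑[ v < n ] (⟦ cell p j v ⟧ * g v)) * H j) ≡ ∑[ v < n ] (g v * h v)
    ∑-regroup g h H h≡H = begin
      ∑[ j < m ] ((∑[ v < n ] (⟦ cell p j v ⟧ * g v)) * H j)
        ≡⟨ sum-cong-≗ (λ j → *-distribʳ-sum (H j) (λ v → ⟦ cell p j v ⟧ * g v)) ⟩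
      ∑[ j < m ] ∑[ v < n ] (⟦ cell p j v ⟧ * g v * H j)
        ≡⟨ sum-cong-≗ (λ j → sum-cong-≗ (λ v → move j v)) ⟩
      ∑[ j < m ] ∑[ v < n ] (⟦ cell p j v ⟧ * (g v * h v))
        ≡⟨ ∑-over-cells (λ v → g v * h v) ⟩
      ∑[ v < n ] (g v * h v) ∎
      where
      move : ∀ j v → ⟦ cell p j v ⟧ * g v * H j ≡ ⟦ cell p j v ⟧ * (g v * h v)
      move j v = trans (*-assoc ⟦ cell p j v ⟧ (g v) (H j))
        (cell-restrict (p v) j (λ pv≡j → cong (g v *_) (trans (cong H (sym pv≡j)) (sym (h≡H v)))))

  module _ {n : ℕ} (Γ : Graph n) where

    degIn≡∑ : ∀ S u → degIn Γ S u ≡ ∑[ v < n ] (⟦ adj Γ u v ⟧ * ⟦ S v ⟧)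
    degIn≡∑ S u = trans (count≡∑ (λ v → adj Γ u v ∧ S v)) (sum-cong-≗ (λ v → ⟦∧⟧ (adj Γ u v) (S v)))

    -- Double counting: both sides count the edges between T and S, since adj is symmetric.
    double-counting : ∀ S T →
      ∑[ u < n ] (⟦ T u ⟧ * degIn Γ S u) ≡ ∑[ u < n ] (⟦ S u ⟧ * degIn Γ T u)
    double-counting S T = begin
      ∑[ u < n ] (⟦ T u ⟧ * degIn Γ S u)
        ≡⟨ sum-cong-≗ (λ u → trans (cong (⟦ T u ⟧ *_) (degIn≡∑ S u))
             (*-distribˡ-sum ⟦ T u ⟧ (λ v → ⟦ adj Γ u v ⟧ * ⟦ S v ⟧))) ⟩
      ∑[ u < n ] ∑[ v < n ] (⟦ T u ⟧ * (⟦ adj Γ u v ⟧ * ⟦ S v ⟧))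
        ≡⟨ ∑-comm (λ u v → ⟦ T u ⟧ * (⟦ adj Γ u v ⟧ * ⟦ S v ⟧)) ⟩
      ∑[ v < n ] ∑[ u < n ] (⟦ T u ⟧ * (⟦ adj Γ u v ⟧ * ⟦ S v ⟧))
        ≡⟨ sum-cong-≗ (λ v → sum-cong-≗ (λ u → edge v u)) ⟩
      ∑[ v < n ] ∑[ u < n ] (⟦ S v ⟧ * (⟦ adj Γ v u ⟧ * ⟦ T u ⟧))
        ≡⟨ sum-cong-≗ (λ v → trans (sym (*-distribˡ-sum ⟦ S v ⟧ (λ u → ⟦ adj Γ v u ⟧ * ⟦ T u ⟧)))
             (cong (⟦ S v ⟧ *_) (sym (degIn≡∑ T v)))) ⟩
      ∑[ v < n ] (⟦ S v ⟧ * degIn Γ T v) ∎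
      where
      open Data.Nat.Solver.+-*-Solver using (solve; _:*_; _:=_)
      edge : ∀ v u → ⟦ T u ⟧ * (⟦ adj Γ u v ⟧ * ⟦ S v ⟧) ≡ ⟦ S v ⟧ * (⟦ adj Γ v u ⟧ * ⟦ T u ⟧)
      edge v u rewrite Graph.sym Γ u v =
        solve 3 (λ t a s → t :* (a :* s) := s :* (a :* t)) refl ⟦ T u ⟧ ⟦ adj Γ v u ⟧ ⟦ S v ⟧

    degIn-over-cells : ∀ {m} (p : Fin n → Fin m) u →
      ∑[ j < m ] degIn Γ (cell p j) u ≡ degIn Γ full u
    degIn-over-cells {m} p u = begin
      ∑[ j < m ] degIn Γ (cell p j) u
        ≡⟨ sum-cong-≗ (λ j → trans (degIn≡∑ (cell p j) u)
             (sum-cong-≗ (λ v → *-comm ⟦ adj Γ u v ⟧ ⟦ cell p j v ⟧))) ⟩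
      ∑[ j < m ] ∑[ v < n ] (⟦ cell p j v ⟧ * ⟦ adj Γ u v ⟧)
        ≡⟨ ∑-over-cells p (λ v → ⟦ adj Γ u v ⟧) ⟩
      ∑[ v < n ] ⟦ adj Γ u v ⟧
        ≡⟨ sum-cong-≗ (λ v → sym (*-identityʳ ⟦ adj Γ u v ⟧)) ⟩
      ∑[ v < n ] (⟦ adj Γ u v ⟧ * 1)
        ≡⟨ sym (degIn≡∑ full u) ⟩
      degIn Γ full u ∎

  module EquitablePartitionFacts {n m : ℕ} {Γ : Graph n} (π : EquitablePartition Γ m) where

    p : Fin n → Fin m
    p = part π

    b : Fin m → Fin m → ℕ
    b = quotient π

    size : Fin m → ℕ
    size i = count (cell p i)

    size-nonZero : ∀ i → NonZero (size i)
    size-nonZero i with isPartition π i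
    ... | u , pu≡i = count-nonZero (cell p i) u (cell-self pu≡i)
      where
      cell-self : ∀ {x j : Fin m} → x ≡ j → ⌊ x ≟ j ⌋ ≡ true
      cell-self {x} {j} x≡j with x ≟ j
      ... | yes _   = refl
      ... | no x≢j = contradiction x≡j x≢j

    edges-between-cells : ∀ i j → ∑[ u < n ] (⟦ cell p i u ⟧ * degIn Γ (cell p j) u) ≡ size i * b i j
    edges-between-cells i j =
      ∑-cell-constant p i (degIn Γ (cell p j)) (λ u pu≡i → trans (equitable π u j) (cong (λ x → b x j) pu≡i))

    quotient-balanced : ∀ i j → size i * b i j ≡ size j * b j i
    quotient-balanced i j = begin
      size i * b i j                                       ≡⟨ sym (edges-between-cells i j) ⟩
      ∑[ u < n ] (⟦ cell p i u ⟧ * degIn Γ (cell p j) u)  ≡⟨ double-counting Γ (cell p j) (cell p i) ⟩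
      ∑[ u < n ] (⟦ cell p j u ⟧ * degIn Γ (cell p i) u)  ≡⟨ edges-between-cells j i ⟩
      size j * b j i                                       ∎

    -- In a d-regular graph every row of b sums to d (evaluate at a vertex of V_i).
    quotient-row-sum : ∀ {d} → Regular Γ d → ∀ i → ∑[ j < m ] b i j ≡ d
    quotient-row-sum {d} regular i with isPartition π i
    ... | u , refl = begin
      ∑[ j < m ] b (p u) j              ≡⟨ sum-cong-≗ (λ j → sym (equitable π u j)) ⟩
      ∑[ j < m ] degIn Γ (cell p j) u  ≡⟨ degIn-over-cells Γ p u ⟩
      degIn Γ full u                   ≡⟨ regular u ⟩
      d                                ∎

    -- For a total perfect code C: Σ_j |V_j ∩ C| b_ji = |V_i|, both sides counting
    -- the edges between C and V_i, each vertex of V_i contributing exactly one.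
    code-column-sum : ∀ {C} → TotalPerfectCode Γ C → ∀ i →
      ∑[ j < m ] (count (λ v → cell p j v ∧ C v) * b j i) ≡ size i
    code-column-sum {C} perfect i = begin
      ∑[ j < m ] (count (λ v → cell p j v ∧ C v) * b j i)
        ≡⟨ sum-cong-≗ (λ j → cong (_* b j i) (trans (count≡∑ (λ v → cell p j v ∧ C v))
             (sum-cong-≗ (λ v → ⟦∧⟧ (cell p j v) (C v))))) ⟩
      ∑[ j < m ] ((∑[ v < n ] (⟦ cell p j v ⟧ * ⟦ C v ⟧)) * b j i)
        ≡⟨ ∑-regroup p (λ v → ⟦ C v ⟧) (degIn Γ (cell p i)) (λ j → b j i) (λ v → equitable π v i) ⟩
      ∑[ v < n ] (⟦ C v ⟧ * degIn Γ (cell p i) v)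
        ≡⟨ double-counting Γ (cell p i) C ⟩
      ∑[ v < n ] (⟦ cell p i v ⟧ * degIn Γ C v)
        ≡⟨ ∑-cell-constant p i (degIn Γ C) (λ v _ → perfect v) ⟩
      size i * 1
        ≡⟨ *-identityʳ (size i) ⟩
      size i ∎

open Counting using (module EquitablePartitionFacts)

open import Data.Integer using (+_)
open import Data.Rational using (ℚ; 0ℚ; 1ℚ; _/_; _+_; _*_; _-_; toℚᵘ)
open import Data.Rational.Properties
  using (toℚᵘ-injective; toℚᵘ-fromℚᵘ; toℚᵘ-homo-+; toℚᵘ-homo-*; +-*-ring; *-identityˡ; *-comm; +-inverseʳ)
import Data.Rational.Unnormalised as ℚᵘ
import Data.Rational.Unnormalised.Properties as ℚᵘ
open import Data.Rational.Unnormalised using (mkℚᵘ; *≡*)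
import Data.Integer as ℤ
import Data.Integer.Properties as ℤ
import Data.Nat as ℕ
open import Data.Rational.Solver using (module +-*-Solver)
open import Algebra.Bundles using (Ring)
module ℚ∑ = SemiringSum (Ring.semiring +-*-ring)

ι : ℕ → ℚ
ι n = + n / 1

-- ι is a semiring homomorphism. Equalities in ℚ are checked on unnormalised
-- representatives, where n/1 is the pair (n, 1) and the arithmetic is componentwise.
ι-+ : ∀ a b → ι (a ℕ.+ b) ≡ ι a + ι b
ι-+ a b = toℚᵘ-injective (begin
  toℚᵘ (ι (a ℕ.+ b))                  ≈⟨ toℚᵘ-fromℚᵘ (mkℚᵘ (+ (a ℕ.+ b)) 0) ⟩
  mkℚᵘ (+ (a ℕ.+ b)) 0                ≈⟨ *≡* (trans (ℤ.*-identityʳ _) (trans (ℤ.pos-+ a b)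
                                          (sym (trans (ℤ.*-identityʳ _)
                                            (cong₂ ℤ._+_ (ℤ.*-identityʳ (+ a)) (ℤ.*-identityʳ (+ b))))))) ⟩
  mkℚᵘ (+ a) 0 ℚᵘ.+ mkℚᵘ (+ b) 0      ≈⟨ ℚᵘ.+-cong (toℚᵘ-fromℚᵘ (mkℚᵘ (+ a) 0)) (toℚᵘ-fromℚᵘ (mkℚᵘ (+ b) 0)) ⟨
  toℚᵘ (ι a) ℚᵘ.+ toℚᵘ (ι b)          ≈⟨ toℚᵘ-homo-+ (ι a) (ι b) ⟨
  toℚᵘ (ι a + ι b)                    ∎)
  where open ℚᵘ.≃-Reasoning

ι-* : ∀ a b → ι (a ℕ.* b) ≡ ι a * ι b
ι-* a b = toℚᵘ-injective (begin
  toℚᵘ (ι (a ℕ.* b))                  ≈⟨ toℚᵘ-fromℚᵘ (mkℚᵘ (+ (a ℕ.* b)) 0) ⟩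
  mkℚᵘ (+ (a ℕ.* b)) 0                ≈⟨ *≡* (cong (ℤ._* + 1) (ℤ.pos-* a b)) ⟩
  mkℚᵘ (+ a) 0 ℚᵘ.* mkℚᵘ (+ b) 0      ≈⟨ ℚᵘ.*-cong (toℚᵘ-fromℚᵘ (mkℚᵘ (+ a) 0)) (toℚᵘ-fromℚᵘ (mkℚᵘ (+ b) 0)) ⟨
  toℚᵘ (ι a) ℚᵘ.* toℚᵘ (ι b)          ≈⟨ toℚᵘ-homo-* (ι a) (ι b) ⟨
  toℚᵘ (ι a * ι b)                    ∎)
  where open ℚᵘ.≃-Reasoning

/-cancel : ∀ c n .{{_ : NonZero n}} → ((+ c) / n) * ι n ≡ ι c
/-cancel c (suc n) = toℚᵘ-injective (begin
  toℚᵘ ((+ c / suc n) * ι (suc n))           ≈⟨ toℚᵘ-homo-* (+ c / suc n) (ι (suc n)) ⟩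
  toℚᵘ (+ c / suc n) ℚᵘ.* toℚᵘ (ι (suc n))  ≈⟨ ℚᵘ.*-cong (toℚᵘ-fromℚᵘ (mkℚᵘ (+ c) n))
                                                            (toℚᵘ-fromℚᵘ (mkℚᵘ (+ suc n) 0)) ⟩
  mkℚᵘ (+ c) n ℚᵘ.* mkℚᵘ (+ suc n) 0        ≈⟨ *≡* (trans (ℤ.*-identityʳ _)
                                                 (cong ((+ c) ℤ.*_) (cong +_ (sym (ℕ.*-identityʳ (suc n)))))) ⟩
  mkℚᵘ (+ c) 0                              ≈⟨ toℚᵘ-fromℚᵘ (mkℚᵘ (+ c) 0) ⟨
  toℚᵘ (ι c)                                ∎)
  where open ℚᵘ.≃-Reasoning

-- The sum Σℚ of Defs is the library's semiring sum over ℚ, whose linearity we reuse.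
Σℚ≡sum : ∀ {m} (f : Fin m → ℚ) → Σℚ f ≡ ℚ∑.sum f
Σℚ≡sum {zero}  f = refl
Σℚ≡sum {suc m} f = cong (_+_ (f zero)) (Σℚ≡sum (f ∘ suc))

Σℚ-cong : ∀ {m} {f g : Fin m → ℚ} → (∀ j → f j ≡ g j) → Σℚ f ≡ Σℚ g
Σℚ-cong {f = f} {g} f≗g = trans (Σℚ≡sum f) (trans (ℚ∑.sum-cong-≗ f≗g) (sym (Σℚ≡sum g)))

Σℚ-+ : ∀ {m} (f g : Fin m → ℚ) → Σℚ (λ j → f j + g j) ≡ Σℚ f + Σℚ g
Σℚ-+ f g = trans (Σℚ≡sum (λ j → f j + g j))
  (trans (ℚ∑.∑-distrib-+ f g) (sym (cong₂ _+_ (Σℚ≡sum f) (Σℚ≡sum g))))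

Σℚ-*ˡ : ∀ {m} x (f : Fin m → ℚ) → Σℚ (λ j → x * f j) ≡ x * Σℚ f
Σℚ-*ˡ x f = trans (Σℚ≡sum (λ j → x * f j))
  (trans (sym (ℚ∑.*-distribˡ-sum x f)) (cong (x *_) (sym (Σℚ≡sum f))))

Σℚ-*ʳ : ∀ {m} x (f : Fin m → ℚ) → Σℚ (λ j → f j * x) ≡ Σℚ f * x
Σℚ-*ʳ x f = trans (Σℚ≡sum (λ j → f j * x))
  (trans (sym (ℚ∑.*-distribʳ-sum x f)) (cong (_* x) (sym (Σℚ≡sum f))))

Σℚ-ι : ∀ {m} (f : Fin m → ℕ) → Σℚ (ι ∘ f) ≡ ι (∑[ j < m ] f j)
Σℚ-ι {zero}  f = refl
Σℚ-ι {suc m} f = trans (cong (_+_ (ι (f zero))) (Σℚ-ι (f ∘ suc))) (sym (ι-+ (f zero) _))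

module QuotientKernel {m d : ℕ} .{{_ : NonZero d}}
  (b : Fin m → Fin m → ℕ) (size code : Fin m → ℕ) (size≢0 : ∀ j → NonZero (size j))
  (balanced   : ∀ i j → size i ℕ.* b i j ≡ size j ℕ.* b j i)
  (column-sum : ∀ i → ∑[ j < m ] (code j ℕ.* b j i) ≡ size i)
  (row-sum    : ∀ i → ∑[ j < m ] b i j ≡ d)
  where

  open +-*-Solver

  density : Fin m → ℚ
  density j = ((+ code j) / size j) {{size≢0 j}}

  inverse-size : Fin m → ℚ
  inverse-size i = ((+ 1) / size i) {{size≢0 i}}

  density-cancel : ∀ j → density j * ι (size j) ≡ ι (code j)
  density-cancel j = /-cancel (code j) (size j) {{size≢0 j}}

  inverse-size-cancel : ∀ i → inverse-size i * ι (size i) ≡ 1ℚ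
  inverse-size-cancel i = /-cancel 1 (size i) {{size≢0 i}}

  -- By balancedness b i j / size j = b j i / size i, hence b i j · density j
  -- = (code j · b j i) / size i.
  transpose-term : ∀ i j → ι (b i j) * density j ≡ inverse-size i * ι (code j ℕ.* b j i)
  transpose-term i j = begin
    ι (b i j) * density j
      ≡⟨ sym (*-identityˡ (ι (b i j) * density j)) ⟩
    1ℚ * (ι (b i j) * density j)
      ≡⟨ cong (_* (ι (b i j) * density j)) (sym (inverse-size-cancel i)) ⟩
    (s * ι (size i)) * (ι (b i j) * density j)
      ≡⟨ solve 4 (λ s n B r → (s :* n) :* (B :* r) := s :* ((n :* B) :* r))
                 refl s (ι (size i)) (ι (b i j)) (density j) ⟩
    s * ((ι (size i) * ι (b i j)) * density j)
      ≡⟨ cong (λ x → s * (x * density j)) balanced-in-ℚ ⟩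
    s * ((ι (size j) * ι (b j i)) * density j)
      ≡⟨ solve 4 (λ s n B r → s :* ((n :* B) :* r) := s :* ((r :* n) :* B))
                 refl s (ι (size j)) (ι (b j i)) (density j) ⟩
    s * ((density j * ι (size j)) * ι (b j i))
      ≡⟨ cong (λ x → s * (x * ι (b j i))) (density-cancel j) ⟩
    s * (ι (code j) * ι (b j i))
      ≡⟨ cong (s *_) (sym (ι-* (code j) (b j i))) ⟩
    s * ι (code j ℕ.* b j i) ∎
    where
    open ≡-Reasoning
    s : ℚ
    s = inverse-size i
    balanced-in-ℚ : ι (size i) * ι (b i j) ≡ ι (size j) * ι (b j i)
    balanced-in-ℚ = trans (sym (ι-* (size i) (b i j))) (trans (cong ι (balanced i j)) (ι-* (size j) (b j i)))

  weighted-density : ∀ i → Σℚ (λ j → ι (b i j) * density j) ≡ 1ℚ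
  weighted-density i = begin
    Σℚ (λ j → ι (b i j) * density j)               ≡⟨ Σℚ-cong (transpose-term i) ⟩
    Σℚ (λ j → s * ι (code j ℕ.* b j i))            ≡⟨ Σℚ-*ˡ s (λ j → ι (code j ℕ.* b j i)) ⟩
    s * Σℚ (λ j → ι (code j ℕ.* b j i))            ≡⟨ cong (s *_) (Σℚ-ι (λ j → code j ℕ.* b j i)) ⟩
    s * ι (∑[ j < m ] (code j ℕ.* b j i))          ≡⟨ cong (λ x → s * ι x) (column-sum i) ⟩
    s * ι (size i)                                 ≡⟨ inverse-size-cancel i ⟩
    1ℚ                                             ∎
    where
    open ≡-Reasoning
    s : ℚ
    s = inverse-size i

  weighted-threshold : ∀ i → Σℚ (λ j → ι (b i j) * ((+ 1) / d)) ≡ 1ℚ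
  weighted-threshold i = begin
    Σℚ (λ j → ι (b i j) * ((+ 1) / d))  ≡⟨ Σℚ-*ʳ ((+ 1) / d) (ι ∘ b i) ⟩
    Σℚ (ι ∘ b i) * ((+ 1) / d)          ≡⟨ cong (_* ((+ 1) / d)) (trans (Σℚ-ι (b i)) (cong ι (row-sum i))) ⟩
    ι d * ((+ 1) / d)                   ≡⟨ *-comm (ι d) ((+ 1) / d) ⟩
    ((+ 1) / d) * ι d                   ≡⟨ /-cancel 1 d ⟩
    1ℚ                                  ∎
    where open ≡-Reasoning

  excess : Fin m → ℚ
  excess j = density j - (+ 1) / d

  excess-in-kernel : ∀ i → Σℚ (λ j → ι (b i j) * excess j) ≡ 0ℚ
  excess-in-kernel i = begin
    S                    ≡⟨ solve 1 (λ S → S := (S :+ con 1ℚ) :- con 1ℚ) refl S ⟩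
    (S + 1ℚ) - 1ℚ        ≡⟨ cong (λ x → (S + x) - 1ℚ) (sym (weighted-threshold i)) ⟩
    (S + T) - 1ℚ         ≡⟨ cong (_- 1ℚ) (sym (Σℚ-+ (λ j → ι (b i j) * excess j) (λ j → ι (b i j) * q))) ⟩
    Σℚ (λ j → ι (b i j) * excess j + ι (b i j) * q) - 1ℚ
                         ≡⟨ cong (_- 1ℚ) (Σℚ-cong (λ j → recombine (ι (b i j)) (density j))) ⟩
    Σℚ (λ j → ι (b i j) * density j) - 1ℚ
                         ≡⟨ cong (_- 1ℚ) (weighted-density i) ⟩
    1ℚ - 1ℚ              ≡⟨ +-inverseʳ 1ℚ ⟩
    0ℚ                   ∎
    where
    open ≡-Reasoning
    q S T : ℚ
    q = (+ 1) / d
    S = Σℚ (λ j → ι (b i j) * excess j)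
    T = Σℚ (λ j → ι (b i j) * q)
    recombine : ∀ B r → B * (r - q) + B * q ≡ B * r
    recombine B r = solve 3 (λ B r q → B :* (r :- q) :+ B :* q := B :* r) refl B r q

  code-via-excess : ∀ i → ι (code i) ≡ ((+ 1) / d + excess i) * ι (size i)
  code-via-excess i = begin
    ι (code i)                         ≡⟨ sym (density-cancel i) ⟩
    density i * ι (size i)             ≡⟨ cong (_* ι (size i)) (solve 2 (λ r q → r := q :+ (r :- q)) refl (density i) q) ⟩
    (q + excess i) * ι (size i)        ∎
    where
    open ≡-Reasoning
    q : ℚ
    q = (+ 1) / d

theorem5p3 : (n d : ℕ) → .{{_ : NonZero d}} → (Γ : Graph n) → Regular Γ d →
    (C : Fin n → Bool) → TotalPerfectCode Γ C →
    (m : ℕ) → (π : EquitablePartition Γ m) →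
    Σ (Fin m → ℚ) λ k →
      (∀ i → (+ count (λ v → cell (part π) i v ∧ C v)) / 1
               ≡ ((+ 1) / d + k i) * ((+ count (cell (part π) i)) / 1))
      × (∀ i → Σℚ (λ j → ((+ quotient π i j) / 1) * k j) ≡ 0ℚ)
theorem5p3 _ _ _ regular C perfect _ π = excess , code-via-excess , excess-in-kernel
  where
  open EquitablePartitionFacts π
  open QuotientKernel (quotient π) size (λ j → count (λ v → cell (part π) j v ∧ C v)) size-nonZero
    quotient-balanced (code-column-sum perfect) (quotient-row-sum regular)
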